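{- Let $\mathscr{A}=(\mathscr{A},{\preccurlyeq_{\mathscr{A}}},{\to_{\mathscr{A}}},S_{\mathscr{A}})$ and $\mathscr{B}=(\mathscr{B},{\preccurlyeq_{\mathscr{B}}},{\to_{\mathscr{B}}},S_{\mathscr{B}})$ be two implicative algebras. If there exists a surjective map $\psi:\mathscr{B}\to\mathscr{A}$ such that (1) $\psi\bigl(\bigwedge_{i\in I}b_i\bigr)=\bigwedge_{i\in I}\psi(b_i)$ for all sets $I$ and $b\in\mathscr{B}^I$, (2) $\psi(b\to_{\mathscr{B}}b')=\psi(b)\to_{\mathscr{A}}\psi(b')$ for all $b,b'\in\mathscr{B}$, (3) $b\in S_{\mathscr{B}}$ iff $\psi(b)\in S_{\mathscr{A}}$ for all $b\in\mathscr{B}$, then the corresponding triposes $\mathsf{P}_{\mathscr{A}},\mathsf{P}_{\mathscr{B}}:\mathbf{Set}^{\mathrm{op}}\to\mathbf{HA}$ are isomorphic.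
   Context: An implicative structure is a complete lattice (meets $\bigwedge$) with an implication $\to$ anti-monotonic in its first and monotonic in its second argument, commuting with arbitrary meets in its second argument. A separator is an upwards closed subset containing $\bigwedge_{a,b}(a\to b\to a)$ and $\bigwedge_{a,b,c}((a\to b\to c)\to(a\to b)\to a\to c)$ and closed under modus ponens; an implicative algebra is an implicative structure with a separator $S$. Its tripos is $\mathsf{P}I=\mathscr{A}^I/S[I]$, where $\mathscr{A}^I$ has componentwise order and implication, $S[I]=\{a\in\mathscr{A}^I:\exists s\in S,\forall i\in I,\ s\preccurlyeq a_i\}$, the quotient is the poset reflection of the preorder $a\vdash b$ iff $(a\to b)\in S[I]$, and $\mathsf{P}f$ is induced by reindexing $a\mapsto a\circ f$. Triposes are isomorphic when there is a natural isomorphism between them. -}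

module Defs where

open import Level using (Level; suc; _⊔_)
open import Data.Product using (Σ; _×_; _,_)
open import Function using (_∘_)
open import Relation.Binary.PropositionalEquality using (_≡_)
open import Relation.Binary.Structures using (IsPartialOrder)

record ImplicativeStructure (ℓ : Level) : Set (suc ℓ) where
  infixr 5 _⇒_
  infix 4 _≼_
  field
    Carrier        : Set ℓ
    _≼_            : Carrier → Carrier → Set ℓ
    isPartialOrder : IsPartialOrder _≡_ _≼_
    ⋀              : {I : Set ℓ} → (I → Carrier) → Carrier
    ⋀-lower        : {I : Set ℓ} (b : I → Carrier) (i : I) → ⋀ b ≼ b i
    ⋀-greatest     : {I : Set ℓ} (b : I → Carrier) (x : Carrier) →
                     ((i : I) → x ≼ b i) → x ≼ ⋀ b
    _⇒_            : Carrier → Carrier → Carrier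
    ⇒-mono         : {a a' b b' : Carrier} → a' ≼ a → b ≼ b' → (a ⇒ b) ≼ (a' ⇒ b')
    ⇒-⋀            : {I : Set ℓ} (a : Carrier) (b : I → Carrier) →
                     (a ⇒ ⋀ b) ≡ ⋀ (λ i → a ⇒ b i)

  𝐊 : Carrier
  𝐊 = ⋀ {Carrier × Carrier} (λ { (a , b) → a ⇒ b ⇒ a })

  𝐒 : Carrier
  𝐒 = ⋀ {Carrier × (Carrier × Carrier)}
        (λ { (a , b , c) → (a ⇒ b ⇒ c) ⇒ (a ⇒ b) ⇒ a ⇒ c })

record Separator {ℓ : Level} (A : ImplicativeStructure ℓ) : Set (suc ℓ) where
  open ImplicativeStructure A
  field
    S       : Carrier → Set ℓ
    upward  : {a b : Carrier} → S a → a ≼ b → S b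
    K∈S     : S 𝐊
    S∈S     : S 𝐒
    mp      : {a b : Carrier} → S (a ⇒ b) → S a → S b

record ImplicativeAlgebra (ℓ : Level) : Set (suc ℓ) where
  field
    struct    : ImplicativeStructure ℓ
    separator : Separator struct
  open ImplicativeStructure struct public
  open Separator separator public

module Tripos {ℓ : Level} (𝒜 : ImplicativeAlgebra ℓ) where
  open ImplicativeAlgebra 𝒜

  S[_] : (I : Set ℓ) → (I → Carrier) → Set ℓ
  S[ I ] a = Σ Carrier (λ s → S s × ((i : I) → s ≼ a i))

  -- entailment preorder on A^I (P I is its poset reflection)
  _⊢_ : {I : Set ℓ} → (I → Carrier) → (I → Carrier) → Set ℓ
  _⊢_ {I} a b = S[ I ] (λ i → a i ⇒ b i)

  -- equality in the quotient P I
  _⊣⊢_ : {I : Set ℓ} → (I → Carrier) → (I → Carrier) → Set ℓ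
  a ⊣⊢ b = (a ⊢ b) × (b ⊢ a)

  reindex : {I J : Set ℓ} → (J → I) → (I → Carrier) → (J → Carrier)
  reindex f a = a ∘ f

-- Since P I is the poset reflection of
-- (A^I, ⊢), maps out of P I are represented by maps on representatives that
-- are monotone for ⊢ (hence respect ⊣⊢); an isomorphism of posets
-- (equivalently of Heyting algebras) is a pair of monotone maps inverse to
-- each other up to ⊣⊢; naturality is commutation with reindexing up to ⊣⊢.
record TriposIso {ℓ : Level} (𝒜 ℬ : ImplicativeAlgebra ℓ) : Set (suc ℓ) where
  private
    module A = ImplicativeAlgebra 𝒜
    module B = ImplicativeAlgebra ℬ
    module PA = Tripos 𝒜
    module PB = Tripos ℬ
  field
    F      : {I : Set ℓ} → (I → A.Carrier) → (I → B.Carrier)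
    G      : {I : Set ℓ} → (I → B.Carrier) → (I → A.Carrier)
    F-mono : {I : Set ℓ} {a a' : I → A.Carrier} → a PA.⊢ a' → F a PB.⊢ F a'
    G-mono : {I : Set ℓ} {b b' : I → B.Carrier} → b PB.⊢ b' → G b PA.⊢ G b'
    G∘F    : {I : Set ℓ} (a : I → A.Carrier) → G (F a) PA.⊣⊢ a
    F∘G    : {I : Set ℓ} (b : I → B.Carrier) → F (G b) PB.⊣⊢ b
    F-nat  : {I J : Set ℓ} (f : J → I) (a : I → A.Carrier) →
             F (PA.reindex f a) PB.⊣⊢ PB.reindex f (F a)

module Submission where

-- An entailment
-- x ⊢ y of families is witnessed uniformly by the meet ⋀ᵢ (xᵢ ⇒ yᵢ)
-- (the separator is upward closed), and ψ maps this meet to the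
-- corresponding meet for ψ ∘ x and ψ ∘ y.  Hence ψ preserves and
-- reflects entailment between families.  The isomorphism of triposes is
-- then G = ψ ∘ _ with inverse F given by a pointwise section of ψ:
-- ψ ∘ F is pointwise the identity, F ∘ ψ is the identity up to ⊣⊢
-- because ψ reflects ⊢, and F commutes with reindexing on the nose.

open import Defs
open import Level using (Level)
open import Data.Product using (Σ; _×_; _,_; proj₁; proj₂)
open import Function using (_∘_)
open import Relation.Binary.PropositionalEquality using (_≡_; refl; sym; subst; cong₂)
open import Relation.Binary.Structures using (IsPartialOrder)

module Entailment {ℓ : Level} (𝒜 : ImplicativeAlgebra ℓ) where
  open ImplicativeAlgebra 𝒜
  open Tripos 𝒜

  ≼-refl : {x : Carrier} → x ≼ x
  ≼-refl = IsPartialOrder.refl isPartialOrder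

  ≼-trans : {x y z : Carrier} → x ≼ y → y ≼ z → x ≼ z
  ≼-trans = IsPartialOrder.trans isPartialOrder

  -- Meets of pointwise equal families are comparable (no function
  -- extensionality is available to identify them).
  ⋀-cong : {I : Set ℓ} {f g : I → Carrier} → ((i : I) → f i ≡ g i) → ⋀ f ≼ ⋀ g
  ⋀-cong {f = f} {g} f≡g =
    ⋀-greatest g (⋀ f) (λ i → subst (⋀ f ≼_) (f≡g i) (⋀-lower f i))

  S⋀-cong : {I : Set ℓ} {f g : I → Carrier} → ((i : I) → f i ≡ g i) → S (⋀ f) → S (⋀ g)
  S⋀-cong f≡g Sf = upward Sf (⋀-cong f≡g)

  S⋀⇒S[] : {I : Set ℓ} (a : I → Carrier) → S (⋀ a) → S[ I ] a
  S⋀⇒S[] a Sa = ⋀ a , Sa , ⋀-lower a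

  S[]⇒S⋀ : {I : Set ℓ} (a : I → Carrier) → S[ I ] a → S (⋀ a)
  S[]⇒S⋀ a (s , Ss , s≼a) = upward Ss (⋀-greatest a s s≼a)

  -- Modus ponens for uniform families: ⋀ᵢ (fᵢ ⇒ gᵢ) ≼ ⋀ f ⇒ ⋀ g.
  ⋀-mp : {I : Set ℓ} (f g : I → Carrier) →
         S (⋀ (λ i → f i ⇒ g i)) → S (⋀ f) → S (⋀ g)
  ⋀-mp f g Sf⇒g Sf = mp (upward Sf⇒g ⋀f⇒g≼) Sf
    where
    ⋀f⇒g≼ : ⋀ (λ i → f i ⇒ g i) ≼ (⋀ f ⇒ ⋀ g)
    ⋀f⇒g≼ = subst (⋀ (λ i → f i ⇒ g i) ≼_) (sym (⇒-⋀ (⋀ f) g))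
      (⋀-greatest _ _ (λ i → ≼-trans (⋀-lower _ i) (⇒-mono (⋀-lower f i) ≼-refl)))

  -- The identity combinator 𝐈 = ⋀ₐ (a ⇒ a) lies in S, because it lies
  -- above 𝐒 𝐊 𝐊 (instantiated uniformly in a).
  𝐈 : Carrier
  𝐈 = ⋀ {Carrier} (λ a → a ⇒ a)

  𝐈∈S : S 𝐈
  𝐈∈S = ⋀-mp _ _ (⋀-mp _ _ 𝐒aaa 𝐊a[a⇒a]) 𝐊aa
    where
    𝐒aaa : S (⋀ {Carrier} (λ a → (a ⇒ (a ⇒ a) ⇒ a) ⇒ (a ⇒ a ⇒ a) ⇒ a ⇒ a))
    𝐒aaa = upward S∈S (⋀-greatest _ _ (λ a → ⋀-lower _ (a , (a ⇒ a) , a)))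
    𝐊a[a⇒a] : S (⋀ {Carrier} (λ a → a ⇒ (a ⇒ a) ⇒ a))
    𝐊a[a⇒a] = upward K∈S (⋀-greatest _ _ (λ a → ⋀-lower _ (a , (a ⇒ a))))
    𝐊aa : S (⋀ {Carrier} (λ a → a ⇒ a ⇒ a))
    𝐊aa = upward K∈S (⋀-greatest _ _ (λ a → ⋀-lower _ (a , a)))

  ⊢-refl : {I : Set ℓ} (a : I → Carrier) → a ⊢ a
  ⊢-refl a = 𝐈 , 𝐈∈S , (λ i → ⋀-lower _ (a i))

  ⊢-cong : {I : Set ℓ} {a a' b b' : I → Carrier} →
           ((i : I) → a i ≡ a' i) → ((i : I) → b i ≡ b' i) → a ⊢ b → a' ⊢ b'
  ⊢-cong a≡a' b≡b' (s , Ss , s≼a⇒b) =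
    s , Ss , (λ i → subst (s ≼_) (cong₂ _⇒_ (a≡a' i) (b≡b' i)) (s≼a⇒b i))

  ≡⇒⊢ : {I : Set ℓ} {a b : I → Carrier} → ((i : I) → a i ≡ b i) → a ⊢ b
  ≡⇒⊢ {a = a} a≡b = ⊢-cong (λ _ → refl) a≡b (⊢-refl a)

  ≡⇒⊣⊢ : {I : Set ℓ} {a b : I → Carrier} → ((i : I) → a i ≡ b i) → a ⊣⊢ b
  ≡⇒⊣⊢ a≡b = ≡⇒⊢ a≡b , ≡⇒⊢ (λ i → sym (a≡b i))

module Morphism {ℓ : Level} (𝒜 ℬ : ImplicativeAlgebra ℓ)
  (ψ : ImplicativeAlgebra.Carrier ℬ → ImplicativeAlgebra.Carrier 𝒜)
  (ψ-⋀ : {I : Set ℓ} (b : I → ImplicativeAlgebra.Carrier ℬ) →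
         ψ (ImplicativeAlgebra.⋀ ℬ b) ≡ ImplicativeAlgebra.⋀ 𝒜 (ψ ∘ b))
  (ψ-⇒ : (b b' : ImplicativeAlgebra.Carrier ℬ) →
         ψ (ImplicativeAlgebra._⇒_ ℬ b b') ≡ ImplicativeAlgebra._⇒_ 𝒜 (ψ b) (ψ b'))
  where
  private
    module A = ImplicativeAlgebra 𝒜
    module B = ImplicativeAlgebra ℬ
    module PA = Tripos 𝒜
    module PB = Tripos ℬ
    module EA = Entailment 𝒜
    module EB = Entailment ℬ

  ψ-witness : {I : Set ℓ} (x y : I → B.Carrier) →
    A.S (ψ (B.⋀ (λ i → x i B.⇒ y i))) → A.S (A.⋀ (λ i → ψ (x i) A.⇒ ψ (y i)))
  ψ-witness x y S⋀ = EA.S⋀-cong (λ i → ψ-⇒ (x i) (y i))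
    (subst A.S (ψ-⋀ (λ i → x i B.⇒ y i)) S⋀)

  ψ-witness⁻¹ : {I : Set ℓ} (x y : I → B.Carrier) →
    A.S (A.⋀ (λ i → ψ (x i) A.⇒ ψ (y i))) → A.S (ψ (B.⋀ (λ i → x i B.⇒ y i)))
  ψ-witness⁻¹ x y S⋀ = subst A.S (sym (ψ-⋀ (λ i → x i B.⇒ y i)))
    (EA.S⋀-cong (λ i → sym (ψ-⇒ (x i) (y i))) S⋀)

  ψ-preserves-⊢ : ((b : B.Carrier) → B.S b → A.S (ψ b)) →
    {I : Set ℓ} {x y : I → B.Carrier} → x PB.⊢ y → (ψ ∘ x) PA.⊢ (ψ ∘ y)
  ψ-preserves-⊢ ψ-S {x = x} {y} x⊢y = EA.S⋀⇒S[] _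
    (ψ-witness x y (ψ-S _ (EB.S[]⇒S⋀ _ x⊢y)))

  ψ-reflects-⊢ : ((b : B.Carrier) → A.S (ψ b) → B.S b) →
    {I : Set ℓ} {x y : I → B.Carrier} → (ψ ∘ x) PA.⊢ (ψ ∘ y) → x PB.⊢ y
  ψ-reflects-⊢ ψ-S⁻¹ {x = x} {y} ψx⊢ψy = EB.S⋀⇒S[] _
    (ψ-S⁻¹ _ (ψ-witness⁻¹ x y (EA.S[]⇒S⋀ _ ψx⊢ψy)))

lemma4p20 : {ℓ : Level} (𝒜 ℬ : ImplicativeAlgebra ℓ) →
    (ψ : ImplicativeAlgebra.Carrier ℬ → ImplicativeAlgebra.Carrier 𝒜) →
    ((a : ImplicativeAlgebra.Carrier 𝒜) → Σ (ImplicativeAlgebra.Carrier ℬ) (λ b → ψ b ≡ a)) →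
    ({I : Set ℓ} (b : I → ImplicativeAlgebra.Carrier ℬ) →
    ψ (ImplicativeAlgebra.⋀ ℬ b) ≡ ImplicativeAlgebra.⋀ 𝒜 (ψ ∘ b)) →
    ((b b' : ImplicativeAlgebra.Carrier ℬ) →
    ψ (ImplicativeAlgebra._⇒_ ℬ b b') ≡ ImplicativeAlgebra._⇒_ 𝒜 (ψ b) (ψ b')) →
    ((b : ImplicativeAlgebra.Carrier ℬ) →
    (ImplicativeAlgebra.S ℬ b → ImplicativeAlgebra.S 𝒜 (ψ b)) ×
    (ImplicativeAlgebra.S 𝒜 (ψ b) → ImplicativeAlgebra.S ℬ b)) →
    TriposIso 𝒜 ℬ
lemma4p20 {ℓ} 𝒜 ℬ ψ surj ψ-⋀ ψ-⇒ ψ-S = record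
  { F      = F
  ; G      = ψ ∘_
  ; F-mono = λ a⊢a' → reflects (EA.⊢-cong (sym ∘ ψψ⁻¹ ∘ _) (sym ∘ ψψ⁻¹ ∘ _) a⊢a')
  ; G-mono = preserves
  ; G∘F    = λ a → EA.≡⇒⊣⊢ (ψψ⁻¹ ∘ a)
  ; F∘G    = λ b → reflects (EA.≡⇒⊢ (ψψ⁻¹ ∘ ψ ∘ b))
                 , reflects (EA.≡⇒⊢ (sym ∘ ψψ⁻¹ ∘ ψ ∘ b))
  ; F-nat  = λ f a → EB.⊢-refl (F a ∘ f) , EB.⊢-refl (F a ∘ f)
  }
  where
  module A = ImplicativeAlgebra 𝒜
  module B = ImplicativeAlgebra ℬ
  module PA = Tripos 𝒜
  module PB = Tripos ℬ
  module EA = Entailment 𝒜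
  module EB = Entailment ℬ
  open Morphism 𝒜 ℬ ψ ψ-⋀ ψ-⇒

  ψ⁻¹ : A.Carrier → B.Carrier
  ψ⁻¹ a = proj₁ (surj a)

  ψψ⁻¹ : (a : A.Carrier) → ψ (ψ⁻¹ a) ≡ a
  ψψ⁻¹ a = proj₂ (surj a)

  F : {I : Set ℓ} → (I → A.Carrier) → (I → B.Carrier)
  F a = ψ⁻¹ ∘ a

  preserves : {I : Set ℓ} {x y : I → B.Carrier} →
              x PB.⊢ y → (ψ ∘ x) PA.⊢ (ψ ∘ y)
  preserves = ψ-preserves-⊢ (proj₁ ∘ ψ-S)

  reflects : {I : Set ℓ} {x y : I → B.Carrier} →
             (ψ ∘ x) PA.⊢ (ψ ∘ y) → x PB.⊢ y
  reflects = ψ-reflects-⊢ (proj₂ ∘ ψ-S)
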